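{- Let $m,n$ be nonnegative integers and let $x,y$ be integers with $x\ge mn$ and $y\ge 1$. Then $$\sum_{k=0}^{n}q^{k(km+k+y-n)}\left({x-km\brack k}{y+km \brack n-k}+\sum_{j=1}^{m}{x-km+j-1\brack k-1}{y+km-j \brack n-k}q^{ -kj}\right)={x+y\brack n}.$$
   Context: The $q$-binomial coefficient is defined by ${z\brack k}=\prod_{i=1}^{k}\frac{1-q^{z-i+1}}{1-q^i}$ if $k\ge 0$ is an integer, and ${z\brack k}=0$ if $k<0$. Here $q$ is an indeterminate and the identity is one of rational functions in $q$. For $m=0$ it reduces to the $q$-Chu–Vandermonde formula. -}

module Defs where

open import Level using (Level)
open import Algebra.Bundles using (CommutativeRing)
open import Data.Nat using (ℕ; zero; suc)
open import Data.Integer using (ℤ; +_; -[1+_])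

-- Data making q an indeterminate-like element of a commutative ring R:
-- q is invertible and every 1 - q^i (i ≥ 1) is invertible, so the
-- product formula for the q-binomial coefficient makes sense.
-- (The universal such R is ℤ[q, q⁻¹, (1-q^i)⁻¹] ⊂ ℚ(q).)
record QData {c ℓ : Level} (R : CommutativeRing c ℓ) : Set (Level._⊔_ c ℓ) where
  open CommutativeRing R
  field
    q      : Carrier
    q⁻¹    : Carrier
    q-inv  : q * q⁻¹ ≈ 1#
    -- den i is the inverse of (1 - q^(i+1))
    den    : ℕ → Carrier

module QOps {c ℓ : Level} (R : CommutativeRing c ℓ) (Q : QData R) where
  open CommutativeRing R
  open QData Q

  -- ring operations under names that do not clash with ℤ's
  _⊕_ _⊗_ : Carrier → Carrier → Carrier
  _⊕_ = _+_
  _⊗_ = _*_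
  _≋_ : Carrier → Carrier → Set ℓ
  _≋_ = _≈_
  infixl 6 _⊕_
  infixl 7 _⊗_
  infix 4 _≋_

  _−_ : Carrier → Carrier → Carrier
  a − b = a + (- b)

  pow : Carrier → ℕ → Carrier
  pow a zero    = 1#
  pow a (suc n) = a * pow a n

  qz : ℤ → Carrier
  qz (+ n)     = pow q n
  qz -[1+ n ]  = pow q⁻¹ (suc n)

  -- prod_{i=1}^{k} (1 - q^{z-i+1}) / (1 - q^i)
  qbinℕ : ℤ → ℕ → Carrier
  qbinℕ z zero    = 1#
  qbinℕ z (suc k) = qbinℕ z k * ((1# − qz (Data.Integer._-_ z (+ k))) * den k)

  qbin : ℤ → ℤ → Carrier
  qbin z (+ k)     = qbinℕ z k
  qbin z -[1+ _ ]  = 0#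

  sum0 : ℕ → (ℕ → Carrier) → Carrier
  sum0 zero    f = f 0
  sum0 (suc n) f = sum0 n f + f (suc n)

  sum1 : ℕ → (ℕ → Carrier) → Carrier
  sum1 zero    f = 0#
  sum1 (suc m) f = sum1 m f + f (suc m)

DenSpec : {c ℓ : Level} (R : CommutativeRing c ℓ) (Q : QData R) → Set ℓ
DenSpec R Q = ∀ i → ((1# + (- pow q (suc i))) * den i) ≈ 1#
  where
  open CommutativeRing R
  open QData Q
  open QOps R Q

module Submission where

-- Write L_n(x,y) for the
-- left-hand side (m fixed); L_n(x,y) = [x+y, n] holds for ALL integers
-- x, y.  From the two
-- q-Pascal rules we derive, summand by summand, three recurrences:
--   (X)  L_{n+1}(x,y) = L_{n+1}(x-1,y) + q^{x+y-n-1} L_n(x-m-1, y+m),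
--   (Y)  L_{n+1}(x,y) = q^{n+1} L_{n+1}(x,y-1) + L_n(x,y-1),
--   (S)  L_n(x,y)     = L_n(x-1,y+1)            (a telescoping sum).
-- By induction on n both L_n terms equal [x+y-1, n], so (X) and (S)+(Y)
-- are two linear equations in L_{n+1}(x,y), L_{n+1}(x-1,y); eliminating
-- the latter gives (1 - q^{n+1}) L_{n+1}(x,y) = (1 - q^{x+y}) [x+y-1, n],
-- i.e. [x+y, n+1] by absorption.

open import Defs
open import Level using (Level)
open import Algebra.Bundles using (CommutativeRing)
open import Data.Nat using (ℕ)
open import Data.Integer using (ℤ; +_; _+_; _-_; _*_; -_; _≤_)

open import Data.Nat as ℕ using (zero; suc)
open import Data.Integer as ℤ using (-[1+_]; _⊖_)
import Data.Integer.Properties as ℤP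
import Data.Nat.Properties as ℕP
open import Data.Integer.Tactic.RingSolver using (solve-∀)
open import Data.Maybe using (Maybe; just; nothing)
open import Relation.Nullary using (yes; no)
import Relation.Binary.PropositionalEquality as ≡
open ≡ using (_≡_)
import Algebra.Solver.Ring.AlmostCommutativeRing as ACR

-- The canonical map ℤ → R is a ring homomorphism; it makes the ring
-- solver available for R with integer coefficients, which is what lets
-- it cancel terms such as a - a.
module IntegerCoefficients {c ℓ : Level} (R : CommutativeRing c ℓ) where
  open CommutativeRing R renaming (_+_ to _+ᴿ_; _*_ to _*ᴿ_; -_ to -ᴿ_; _-_ to _-ᴿ_)
  open import Algebra.Properties.Ring ring
    using (-‿involutive; -‿distribˡ-*; -‿distribʳ-*; -0#≈0#; -‿+-comm)
  open import Algebra.Properties.Semiring.Mult.TCOptimised semiring using (_×_; ×-homo-+; ×1-homo-*)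
  open import Relation.Binary.Reasoning.Setoid setoid

  ⟦_⟧ℤ : ℤ → Carrier
  ⟦ + n ⟧ℤ     = n × 1#
  ⟦ -[1+ n ] ⟧ℤ = -ᴿ (suc n × 1#)

  ⟦⟧-neg : ∀ i → ⟦ - i ⟧ℤ ≈ -ᴿ ⟦ i ⟧ℤ
  ⟦⟧-neg (+ zero)  = sym -0#≈0#
  ⟦⟧-neg (+ suc n) = refl
  ⟦⟧-neg -[1+ n ]  = sym (-‿involutive _)

  -- the optimised multiple _×_ makes ⟦ + 1 ⟧ℤ definitionally 1#, as the
  -- solver requires; its recursion equation holds up to ≈
  ⟦suc⟧ : ∀ n → suc n × 1# ≈ 1# +ᴿ n × 1#
  ⟦suc⟧ = ×-homo-+ 1# 1

  -- (1 + a) - (1 + b) = a - b, the inductive step for m ⊖ n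
  ⟦⟧-⊖ : ∀ m n → ⟦ m ⊖ n ⟧ℤ ≈ m × 1# +ᴿ -ᴿ (n × 1#)
  ⟦⟧-⊖ m       zero    = sym (trans (+-congˡ -0#≈0#) (+-identityʳ _))
  ⟦⟧-⊖ zero    (suc n) = sym (+-identityˡ _)
  ⟦⟧-⊖ (suc m) (suc n) = begin
    ⟦ suc m ⊖ suc n ⟧ℤ             ≡⟨ ≡.cong ⟦_⟧ℤ (ℤP.[1+m]⊖[1+n]≡m⊖n m n) ⟩
    ⟦ m ⊖ n ⟧ℤ                     ≈⟨ ⟦⟧-⊖ m n ⟩
    a +ᴿ -ᴿ b                      ≈⟨ +-congʳ (sym (+-identityˡ _)) ⟩
    (0# +ᴿ a) +ᴿ -ᴿ b              ≈⟨ +-congʳ (+-congʳ (sym (-‿inverseʳ 1#))) ⟩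
    ((1# +ᴿ -ᴿ 1#) +ᴿ a) +ᴿ -ᴿ b   ≈⟨ +-congʳ (trans (+-assoc _ _ _) (trans (+-congˡ (+-comm _ _)) (sym (+-assoc _ _ _)))) ⟩
    ((1# +ᴿ a) +ᴿ -ᴿ 1#) +ᴿ -ᴿ b   ≈⟨ +-assoc _ _ _ ⟩
    (1# +ᴿ a) +ᴿ (-ᴿ 1# +ᴿ -ᴿ b)   ≈⟨ +-congˡ (-‿+-comm _ _) ⟩
    (1# +ᴿ a) +ᴿ -ᴿ (1# +ᴿ b)      ≈⟨ +-cong (⟦suc⟧ m) (-‿cong (⟦suc⟧ n)) ⟨
    suc m × 1# +ᴿ -ᴿ (suc n × 1#)  ∎
    where
    a = m × 1#
    b = n × 1#

  ⟦⟧-+ : ∀ i j → ⟦ i + j ⟧ℤ ≈ ⟦ i ⟧ℤ +ᴿ ⟦ j ⟧ℤ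
  ⟦⟧-+ (+ m)    (+ n)    = ×-homo-+ 1# m n
  ⟦⟧-+ (+ m)    -[1+ n ] = ⟦⟧-⊖ m (suc n)
  ⟦⟧-+ -[1+ m ] (+ n)    = trans (⟦⟧-⊖ n (suc m)) (+-comm _ _)
  ⟦⟧-+ -[1+ m ] -[1+ n ] = begin
    -ᴿ (suc (suc (m ℕ.+ n)) × 1#)          ≡⟨ ≡.cong (λ t → -ᴿ (t × 1#)) (≡.sym (ℕP.+-suc (suc m) n)) ⟩
    -ᴿ ((suc m ℕ.+ suc n) × 1#)            ≈⟨ -‿cong (×-homo-+ 1# (suc m) (suc n)) ⟩
    -ᴿ (suc m × 1# +ᴿ suc n × 1#)          ≈⟨ -‿+-comm _ _ ⟨
    -ᴿ (suc m × 1#) +ᴿ -ᴿ (suc n × 1#)     ∎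

  ⟦⟧-*-nonneg : ∀ m j → ⟦ + m * j ⟧ℤ ≈ ⟦ + m ⟧ℤ *ᴿ ⟦ j ⟧ℤ
  ⟦⟧-*-nonneg m (+ n) = trans (reflexive (≡.cong ⟦_⟧ℤ (≡.sym (ℤP.pos-* m n)))) (×1-homo-* m n)
  ⟦⟧-*-nonneg m -[1+ n ] = begin
    ⟦ + m * - + suc n ⟧ℤ          ≡⟨ ≡.cong ⟦_⟧ℤ (≡.sym (ℤP.neg-distribʳ-* (+ m) (+ suc n))) ⟩
    ⟦ - (+ m * + suc n) ⟧ℤ        ≈⟨ ⟦⟧-neg (+ m * + suc n) ⟩
    -ᴿ ⟦ + m * + suc n ⟧ℤ         ≈⟨ -‿cong (⟦⟧-*-nonneg m (+ suc n)) ⟩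
    -ᴿ (⟦ + m ⟧ℤ *ᴿ ⟦ + suc n ⟧ℤ)  ≈⟨ -‿distribʳ-* _ _ ⟩
    ⟦ + m ⟧ℤ *ᴿ ⟦ -[1+ n ] ⟧ℤ      ∎

  ⟦⟧-* : ∀ i j → ⟦ i * j ⟧ℤ ≈ ⟦ i ⟧ℤ *ᴿ ⟦ j ⟧ℤ
  ⟦⟧-* (+ m) j = ⟦⟧-*-nonneg m j
  ⟦⟧-* -[1+ m ] j = begin
    ⟦ - + suc m * j ⟧ℤ            ≡⟨ ≡.cong ⟦_⟧ℤ (≡.sym (ℤP.neg-distribˡ-* (+ suc m) j)) ⟩
    ⟦ - (+ suc m * j) ⟧ℤ          ≈⟨ ⟦⟧-neg (+ suc m * j) ⟩
    -ᴿ ⟦ + suc m * j ⟧ℤ           ≈⟨ -‿cong (⟦⟧-*-nonneg (suc m) j) ⟩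
    -ᴿ (⟦ + suc m ⟧ℤ *ᴿ ⟦ j ⟧ℤ)    ≈⟨ -‿distribˡ-* _ _ ⟩
    ⟦ -[1+ m ] ⟧ℤ *ᴿ ⟦ j ⟧ℤ        ∎

  homomorphism : CommutativeRing.rawRing ℤP.+-*-commutativeRing
                   ACR.-Raw-AlmostCommutative⟶ ACR.fromCommutativeRing R
  homomorphism = record
    { ⟦_⟧ = ⟦_⟧ℤ ; +-homo = ⟦⟧-+ ; *-homo = ⟦⟧-* ; -‿homo = ⟦⟧-neg
    ; 0-homo = refl ; 1-homo = refl }

  coefficient≟ : ∀ i j → Maybe (⟦ i ⟧ℤ ≈ ⟦ j ⟧ℤ)
  coefficient≟ i j with i ℤ.≟ j
  ... | yes i≡j = just (reflexive (≡.cong ⟦_⟧ℤ i≡j))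
  ... | no _    = nothing

  open import Algebra.Solver.Ring (CommutativeRing.rawRing ℤP.+-*-commutativeRing)
    (ACR.fromCommutativeRing R) homomorphism coefficient≟
    using (solve; _:=_; _:+_; _:*_; _:-_; con) public

module QPowers {c ℓ : Level} (R : CommutativeRing c ℓ) (Q : QData R) where
  open CommutativeRing R renaming (_+_ to _+ᴿ_; _*_ to _*ᴿ_; -_ to -ᴿ_; _-_ to _-ᴿ_)
  open QData Q
  open QOps R Q
  open IntegerCoefficients R
  open import Relation.Binary.Reasoning.Setoid setoid

  pow-+ : ∀ a m n → pow a (m ℕ.+ n) ≈ pow a m ⊗ pow a n
  pow-+ a zero    n = sym (*-identityˡ _)
  pow-+ a (suc m) n = trans (*-congˡ (pow-+ a m n)) (sym (*-assoc _ _ _))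

  -- q^(m - n) = q^m q⁻ⁿ; cancelling one q q⁻¹ = 1 per step
  qz-⊖ : ∀ m n → qz (m ⊖ n) ≈ pow q m ⊗ pow q⁻¹ n
  qz-⊖ m       zero    = sym (*-identityʳ _)
  qz-⊖ zero    (suc n) = sym (*-identityˡ _)
  qz-⊖ (suc m) (suc n) = begin
    qz (suc m ⊖ suc n)                  ≡⟨ ≡.cong qz (ℤP.[1+m]⊖[1+n]≡m⊖n m n) ⟩
    qz (m ⊖ n)                          ≈⟨ qz-⊖ m n ⟩
    u ⊗ v                               ≈⟨ *-identityˡ _ ⟨
    1# ⊗ (u ⊗ v)                        ≈⟨ *-congʳ q-inv ⟨
    (q ⊗ q⁻¹) ⊗ (u ⊗ v)                 ≈⟨ solve 4 (λ a b u v → (a :* b) :* (u :* v) := (a :* u) :* (b :* v)) refl q q⁻¹ u v ⟩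
    (q ⊗ u) ⊗ (q⁻¹ ⊗ v)                 ∎
    where
    u = pow q m
    v = pow q⁻¹ n

  qz-+ : ∀ i j → qz (i + j) ≈ qz i ⊗ qz j
  qz-+ (+ m)    (+ n)    = pow-+ q m n
  qz-+ (+ m)    -[1+ n ] = qz-⊖ m (suc n)
  qz-+ -[1+ m ] (+ n)    = trans (qz-⊖ n (suc m)) (*-comm _ _)
  qz-+ -[1+ m ] -[1+ n ] = begin
    pow q⁻¹ (suc (suc (m ℕ.+ n)))       ≡⟨ ≡.cong (pow q⁻¹) (≡.sym (ℕP.+-suc (suc m) n)) ⟩
    pow q⁻¹ (suc m ℕ.+ suc n)           ≈⟨ pow-+ q⁻¹ (suc m) (suc n) ⟩
    pow q⁻¹ (suc m) ⊗ pow q⁻¹ (suc n)   ∎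

  -- exponents are compared by integer identities, proved by the ℤ solver
  qz-cong : ∀ {i j} → i ≡ j → qz i ≈ qz j
  qz-cong i≡j = reflexive (≡.cong qz i≡j)

  qz-merge : ∀ a b c → a + b ≡ c → qz a ⊗ qz b ≈ qz c
  qz-merge a b c e = trans (sym (qz-+ a b)) (qz-cong e)

  qz-regroup : ∀ a b c d → a + b ≡ c + d → qz a ⊗ qz b ≈ qz c ⊗ qz d
  qz-regroup a b c d e = trans (qz-merge a b (c + d) e) (qz-+ c d)

module FiniteSums {c ℓ : Level} (R : CommutativeRing c ℓ) (Q : QData R) where
  open CommutativeRing R renaming (_+_ to _+ᴿ_; _*_ to _*ᴿ_; -_ to -ᴿ_; _-_ to _-ᴿ_)
  open QOps R Q
  open IntegerCoefficients R

  interchange : ∀ a b c d → (a ⊕ b) ⊕ (c ⊕ d) ≈ (a ⊕ c) ⊕ (b ⊕ d)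
  interchange = solve 4 (λ a b c d → (a :+ b) :+ (c :+ d) := (a :+ c) :+ (b :+ d)) refl

  sum0-cong : ∀ n {f g} → (∀ k → f k ≈ g k) → sum0 n f ≈ sum0 n g
  sum0-cong zero    f≈g = f≈g 0
  sum0-cong (suc n) f≈g = +-cong (sum0-cong n f≈g) (f≈g (suc n))

  sum0-+ : ∀ n (f g : ℕ → Carrier) → sum0 n (λ k → f k ⊕ g k) ≈ sum0 n f ⊕ sum0 n g
  sum0-+ zero    f g = refl
  sum0-+ (suc n) f g = trans (+-congʳ (sum0-+ n f g)) (interchange _ _ _ _)

  sum0-* : ∀ n a (f : ℕ → Carrier) → sum0 n (λ k → a ⊗ f k) ≈ a ⊗ sum0 n f
  sum0-* zero    a f = refl
  sum0-* (suc n) a f = trans (+-congʳ (sum0-* n a f)) (sym (distribˡ _ _ _))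

  sum0-telescope : ∀ n (g : ℕ → Carrier) → sum0 n (λ k → g k − g (suc k)) ≈ g 0 − g (suc n)
  sum0-telescope zero    g = refl
  sum0-telescope (suc n) g = trans (+-congʳ (sum0-telescope n g))
    (solve 3 (λ a b c → (a :- b) :+ (b :- c) := a :- c) refl _ _ _)

  sum0-first : ∀ n (f : ℕ → Carrier) → sum0 (suc n) f ≈ f 0 ⊕ sum0 n (λ k → f (suc k))
  sum0-first zero    f = refl
  sum0-first (suc n) f = trans (+-congʳ (sum0-first n f)) (+-assoc _ _ _)

  sum1-cong : ∀ m {f g} → (∀ j → f (suc j) ≈ g (suc j)) → sum1 m f ≈ sum1 m g
  sum1-cong zero    f≈g = refl
  sum1-cong (suc m) f≈g = +-cong (sum1-cong m f≈g) (f≈g m)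

  sum1-+ : ∀ m (f g : ℕ → Carrier) → sum1 m (λ j → f j ⊕ g j) ≈ sum1 m f ⊕ sum1 m g
  sum1-+ zero    f g = sym (+-identityʳ _)
  sum1-+ (suc m) f g = trans (+-congʳ (sum1-+ m f g)) (interchange _ _ _ _)

  sum1-* : ∀ m a (f : ℕ → Carrier) → sum1 m (λ j → a ⊗ f j) ≈ a ⊗ sum1 m f
  sum1-* zero    a f = sym (zeroʳ _)
  sum1-* (suc m) a f = trans (+-congʳ (sum1-* m a f)) (sym (distribˡ _ _ _))

  sum1-zero : ∀ m {f} → (∀ j → f (suc j) ≈ 0#) → sum1 m f ≈ 0#
  sum1-zero zero    f≈0 = refl
  sum1-zero (suc m) f≈0 = trans (+-cong (sum1-zero m f≈0) (f≈0 m)) (+-identityʳ _)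

  sum1-shift : ∀ m (h : ℕ → Carrier) → sum1 m h ≈ sum1 m (λ j → h (ℕ.pred j)) ⊕ (h m − h 0)
  sum1-shift zero    h = sym (trans (+-identityˡ _) (-‿inverseʳ _))
  sum1-shift (suc m) h = trans (+-congʳ (sum1-shift m h))
    (solve 4 (λ a b c d → (a :+ (b :- c)) :+ d := (a :+ b) :+ (d :- c)) refl _ _ _ _)

module QBinomials {c ℓ : Level} (R : CommutativeRing c ℓ) (Q : QData R) (ds : DenSpec R Q) where
  open CommutativeRing R renaming (_+_ to _+ᴿ_; _*_ to _*ᴿ_; -_ to -ᴿ_; _-_ to _-ᴿ_)
  open QData Q
  open QOps R Q
  open IntegerCoefficients R
  open QPowers R Q
  open import Relation.Binary.Reasoning.Setoid setoid

  qbin-cong : ∀ {z w u v} → z ≡ w → u ≡ v → qbin z u ≈ qbin w v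
  qbin-cong z≡w u≡v = reflexive (≡.cong₂ qbin z≡w u≡v)

  qbin-congˡ : ∀ u {z w} → z ≡ w → qbin z u ≈ qbin w u
  qbin-congˡ u z≡w = qbin-cong {u = u} z≡w ≡.refl

  -- [z, -1] = 0, with -1 written as n - (n+1) as in the boundary terms
  qbin-minus-one : ∀ n z → qbin z (+ n - + suc n) ≈ 0#
  qbin-minus-one n z = qbin-cong {u = + n - + suc n} ≡.refl (minus-one (+ n))
    where
    minus-one : ∀ n → n - (+ 1 + n) ≡ - + 1
    minus-one = solve-∀

  qbinℕ-step : ∀ z k → qbinℕ (z - + 1) (suc k) ≈ qbinℕ (z - + 1) k ⊗ ((1# − qz (z - + suc k)) ⊗ den k)
  qbinℕ-step z k = *-congˡ (*-congʳ (+-congˡ (-‿cong (qz-cong (shift z (+ k))))))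
    where
    shift : ∀ z k → z - + 1 - k ≡ z - (+ 1 + k)
    shift = solve-∀

  absorb : ∀ z k → qbinℕ z (suc k) ≈ (1# − qz z) ⊗ qbinℕ (z - + 1) k ⊗ den k
  absorb z zero = trans (*-congˡ (*-congʳ (+-congˡ (-‿cong (qz-cong (ℤP.+-identityʳ z))))))
    (solve 3 (λ o s d → o :* (s :* d) := s :* o :* d) refl 1# (1# − qz z) (den 0))
  absorb z (suc k) = begin
    qbinℕ z (suc k) ⊗ ((1# − a) ⊗ den (suc k))             ≈⟨ *-congʳ (absorb z k) ⟩
    (1# − qz z) ⊗ b ⊗ den k ⊗ ((1# − a) ⊗ den (suc k))     ≈⟨ solve 5 (λ s b d e f → s :* b :* d :* (e :* f) := s :* (b :* (e :* d)) :* f)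
                                                                 refl (1# − qz z) b (den k) (1# − a) (den (suc k)) ⟩
    (1# − qz z) ⊗ (b ⊗ ((1# − a) ⊗ den k)) ⊗ den (suc k)   ≈⟨ *-congʳ (*-congˡ (qbinℕ-step z k)) ⟨
    (1# − qz z) ⊗ qbinℕ (z - + 1) (suc k) ⊗ den (suc k)   ∎
    where
    a = qz (z - + suc k)
    b = qbinℕ (z - + 1) k

  exponents-add : ∀ z k → qz (z - + suc k) ⊗ pow q (suc k) ≈ qz z
  exponents-add z k = qz-merge (z - + suc k) (+ suc k) z (cancel z (+ suc k))
    where
    cancel : ∀ z k → z - k + k ≡ z
    cancel = solve-∀

  -- Both Pascal rules come from writing 1 - q^z = 1 - q^(z-k-1) q^(k+1)
  -- in the absorption formula and splitting it in the two possible ways.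
  module _ (z : ℤ) (k : ℕ) where
    private
      a = qz (z - + suc k)
      b = pow q (suc k)
      B = qbinℕ (z - + 1) k
      d = den k

      absorb-split : qbinℕ z (suc k) ≈ (1# − (a ⊗ b)) ⊗ B ⊗ d
      absorb-split = trans (absorb z k) (*-congʳ (*-congʳ (+-congˡ (-‿cong (sym (exponents-add z k))))))

      B-unit : B ⊗ ((1# − b) ⊗ d) ≈ B
      B-unit = trans (*-congˡ (ds k)) (*-identityʳ B)

    pascal₁ℕ : qbinℕ z (suc k) ≈ qbinℕ (z - + 1) (suc k) ⊕ a ⊗ B
    pascal₁ℕ = begin
      qbinℕ z (suc k)                                 ≈⟨ absorb-split ⟩
      (1# − (a ⊗ b)) ⊗ B ⊗ d                            ≈⟨ solve 4 (λ a b B d → (con (+ 1) :- a :* b) :* B :* d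
                                                           := B :* ((con (+ 1) :- a) :* d) :+ a :* (B :* ((con (+ 1) :- b) :* d))) refl a b B d ⟩
      B ⊗ ((1# − a) ⊗ d) ⊕ a ⊗ (B ⊗ ((1# − b) ⊗ d))  ≈⟨ +-cong (qbinℕ-step z k) (*-congˡ (sym B-unit)) ⟨
      qbinℕ (z - + 1) (suc k) ⊕ a ⊗ B                 ∎

    pascal₂ℕ : qbinℕ z (suc k) ≈ b ⊗ qbinℕ (z - + 1) (suc k) ⊕ B
    pascal₂ℕ = begin
      qbinℕ z (suc k)                                 ≈⟨ absorb-split ⟩
      (1# − (a ⊗ b)) ⊗ B ⊗ d                            ≈⟨ solve 4 (λ a b B d → (con (+ 1) :- a :* b) :* B :* d
                                                           := b :* (B :* ((con (+ 1) :- a) :* d)) :+ B :* ((con (+ 1) :- b) :* d)) refl a b B d ⟩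
      b ⊗ (B ⊗ ((1# − a) ⊗ d)) ⊕ B ⊗ ((1# − b) ⊗ d)  ≈⟨ +-cong (*-congˡ (qbinℕ-step z k)) (sym B-unit) ⟨
      b ⊗ qbinℕ (z - + 1) (suc k) ⊕ B                 ∎

  pascal₁ : ∀ z w → qbin z w ≈ qbin (z - + 1) w ⊕ qz (z - w) ⊗ qbin (z - + 1) (w - + 1)
  pascal₁ z (+ zero)  = sym (trans (+-congˡ (zeroʳ _)) (+-identityʳ _))
  pascal₁ z (+ suc k) = pascal₁ℕ z k
  pascal₁ z -[1+ n ]  = sym (trans (+-congˡ (zeroʳ _)) (+-identityʳ _))

  pascal₂ : ∀ z w → qbin z w ≈ qz w ⊗ qbin (z - + 1) w ⊕ qbin (z - + 1) (w - + 1)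
  pascal₂ z (+ zero)  = sym (trans (+-identityʳ _) (*-identityˡ _))
  pascal₂ z (+ suc k) = pascal₂ℕ z k
  pascal₂ z -[1+ n ]  = sym (trans (+-identityʳ _) (zeroʳ _))

module LeftHandSide {c ℓ : Level} (R : CommutativeRing c ℓ) (Q : QData R) (ds : DenSpec R Q) (m : ℕ) where
  open CommutativeRing R renaming (_+_ to _+ᴿ_; _*_ to _*ᴿ_; -_ to -ᴿ_; _-_ to _-ᴿ_)
  open QData Q
  open QOps R Q
  open IntegerCoefficients R
  open QPowers R Q
  open FiniteSums R Q
  open QBinomials R Q ds
  open import Algebra.Properties.Ring ring using (-0#≈0#)
  open import Relation.Binary.Reasoning.Setoid setoid

  expo : ℕ → ℤ → ℕ → ℤ
  expo n y k = + k * (+ k * + m + + k + y - + n)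

  lead : ℕ → ℤ → ℤ → ℕ → Carrier
  lead n x y k = qbin (x - + k * + m) (+ k) ⊗ qbin (y + + k * + m) (+ n - + k)

  corr : ℕ → ℤ → ℤ → ℕ → ℕ → Carrier
  corr n x y k j = (qbin (x - + k * + m + + j - + 1) (+ k - + 1) ⊗ qbin (y + + k * + m - + j) (+ n - + k))
                   ⊗ qz (- (+ k * + j))

  term : ℕ → ℤ → ℤ → ℕ → Carrier
  term n x y k = qz (expo n y k) ⊗ (lead n x y k ⊕ sum1 m (corr n x y k))

  lhs : ℕ → ℤ → ℤ → Carrier
  lhs n x y = sum0 n (term n x y)

  -- the summand k = n + 1 of L_n vanishes, since it contains [·, -1]
  term-beyond : ∀ n x y → term n x y (suc n) ≈ 0#
  term-beyond n x y = trans (*-congˡ (trans (+-cong lead≈0 (sum1-zero m corr≈0)) (+-identityʳ _))) (zeroʳ _)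
    where
    lead≈0 : lead n x y (suc n) ≈ 0#
    lead≈0 = trans (*-congˡ (qbin-minus-one n _)) (zeroʳ _)
    corr≈0 : ∀ j → corr n x y (suc n) (suc j) ≈ 0#
    corr≈0 j = trans (*-congʳ (trans (*-congˡ (qbin-minus-one n _)) (zeroʳ _))) (zeroˡ _)

  -- Recurrence (Y), summand by summand: Pascal's rule pascal₂ applied to
  -- the factor [y+km(-j), n+1-k] of every product.
  module _ (n : ℕ) (x y : ℤ) (k : ℕ) where
    private
      l  = + suc n - + k
      ql = qz l
      y' = y - + 1

      split : ∀ Y Y' → Y - + 1 ≡ Y' → qbin Y l ≈ ql ⊗ qbin Y' l ⊕ qbin Y' (+ n - + k)
      split Y Y' Y-1≡Y' = trans (pascal₂ Y l) (+-cong (*-congˡ (qbin-congˡ l Y-1≡Y')) (qbin-cong Y-1≡Y' (lower (+ n) (+ k))))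
        where
        lower : ∀ n k → (+ 1 + n - k) - + 1 ≡ n - k
        lower = solve-∀

      lead-split : lead (suc n) x y k ≈ ql ⊗ lead (suc n) x y' k ⊕ lead n x y' k
      lead-split = trans (*-congˡ (split (y + + k * + m) (y' + + k * + m) (reorder y (+ k * + m))))
        (solve 4 (λ a ql b b' → a :* (ql :* b :+ b') := ql :* (a :* b) :+ a :* b') refl _ _ _ _)
        where
        reorder : ∀ y t → y + t - + 1 ≡ y - + 1 + t
        reorder = solve-∀

      corr-split : ∀ j → corr (suc n) x y k j ≈ ql ⊗ corr (suc n) x y' k j ⊕ corr n x y' k j
      corr-split j = trans (*-congʳ (*-congˡ (split (y + + k * + m - + j) (y' + + k * + m - + j) (reorder y (+ k * + m) (+ j)))))
        (solve 5 (λ a ql b b' e → a :* (ql :* b :+ b') :* e := ql :* (a :* b :* e) :+ a :* b' :* e) refl _ _ _ _ _)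
        where
        reorder : ∀ y t j → y + t - j - + 1 ≡ y - + 1 + t - j
        reorder = solve-∀

      expo-merge : qz (expo (suc n) y k) ⊗ ql ≈ pow q (suc n) ⊗ qz (expo (suc n) y' k)
      expo-merge = qz-regroup (expo (suc n) y k) l (+ suc n) (expo (suc n) y' k) (exponents (+ k) (+ m) y (+ n))
        where
        exponents : ∀ k m y n → k * (k * m + k + y - (+ 1 + n)) + ((+ 1 + n) - k)
                                ≡ (+ 1 + n) + k * (k * m + k + (y - + 1) - (+ 1 + n))
        exponents = solve-∀

      expo-same : expo (suc n) y k ≡ expo n y' k
      expo-same = exponents (+ k) (+ m) y (+ n)
        where
        exponents : ∀ k m y n → k * (k * m + k + y - (+ 1 + n)) ≡ k * (k * m + k + (y - + 1) - n)
        exponents = solve-∀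

    term-y-step : term (suc n) x y k ≈ pow q (suc n) ⊗ term (suc n) x y' k ⊕ term n x y' k
    term-y-step = begin
      e ⊗ (lead (suc n) x y k ⊕ sum1 m (corr (suc n) x y k))
        ≈⟨ *-congˡ (+-cong lead-split (trans (sum1-cong m (λ j → corr-split (suc j)))
                                         (trans (sum1-+ m _ _) (+-congʳ (sum1-* m ql _))))) ⟩
      e ⊗ ((ql ⊗ A₁ ⊕ A₀) ⊕ (ql ⊗ S₁ ⊕ S₀))
        ≈⟨ solve 6 (λ e ql a₁ a₀ s₁ s₀ → e :* ((ql :* a₁ :+ a₀) :+ (ql :* s₁ :+ s₀))
                     := (e :* ql) :* (a₁ :+ s₁) :+ e :* (a₀ :+ s₀)) refl _ _ _ _ _ _ ⟩
      (e ⊗ ql) ⊗ (A₁ ⊕ S₁) ⊕ e ⊗ (A₀ ⊕ S₀)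
        ≈⟨ +-cong (trans (*-congʳ expo-merge) (*-assoc _ _ _)) (*-congʳ (qz-cong expo-same)) ⟩
      pow q (suc n) ⊗ term (suc n) x y' k ⊕ term n x y' k ∎
      where
      e  = qz (expo (suc n) y k)
      A₁ = lead (suc n) x y' k
      A₀ = lead n x y' k
      S₁ = sum1 m (corr (suc n) x y' k)
      S₀ = sum1 m (corr n x y' k)

  -- Recurrence (S) summand by summand: the summand changes under
  -- (x,y) ↦ (x-1,y+1) by a difference edge k - edge (k+1), where edge k
  -- is the summand's j = m correction term.
  edge : ℕ → ℤ → ℤ → ℕ → Carrier
  edge n x y k = qz (expo n y k) ⊗ corr n x y k m

  module _ (n : ℕ) (x y : ℤ) (k : ℕ) where
    private
      X  = x - + k * + m
      Y  = y + + k * + m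
      lw = + n - + k
      cq = pow q k
      E  = expo n y k
      a₁ = qbin (X - + 1) (+ k)
      a₀ = qbin (X - + 1) (+ k - + 1)
      b₁ = qbin Y lw
      b₀ = qbin Y (lw - + 1)
      w  = qz (Y + + 1 - lw)
      h  = corr n x y k
      S' = sum1 m (corr n (x - + 1) (y + + 1) k)

      lead-pascal : lead n x y k ≈ (cq ⊗ a₁ ⊕ a₀) ⊗ b₁
      lead-pascal = *-congʳ (pascal₂ X (+ k))

      lead-shifted : lead n (x - + 1) (y + + 1) k ≈ a₁ ⊗ (b₁ ⊕ w ⊗ b₀)
      lead-shifted = *-cong (qbin-congˡ (+ k) (swap x (+ k * + m)))
        (trans (qbin-congˡ lw (regroup y (+ k * + m)))
          (trans (pascal₁ (Y + + 1) lw) (+-cong (qbin-congˡ lw (cancel Y)) (*-congˡ (qbin-congˡ (lw - + 1) (cancel Y))))))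
        where
        swap : ∀ x t → x - + 1 - t ≡ x - t - + 1
        swap = solve-∀
        regroup : ∀ y t → y + + 1 + t ≡ y + t + + 1
        regroup = solve-∀
        cancel : ∀ y → y + + 1 - + 1 ≡ y
        cancel = solve-∀

      corr-shifted : ∀ j → h j ≈ cq ⊗ corr n (x - + 1) (y + + 1) k (suc j)
      corr-shifted j = sym (begin
        cq ⊗ ((P ⊗ P') ⊗ qz (- (+ k * + suc j)))
          ≈⟨ solve 4 (λ c p p' e → c :* ((p :* p') :* e) := (p :* p') :* (c :* e)) refl _ _ _ _ ⟩
        (P ⊗ P') ⊗ (cq ⊗ qz (- (+ k * + suc j)))
          ≈⟨ *-cong (*-cong (qbin-congˡ (+ k - + 1) (lower x (+ k * + m) (+ j))) (qbin-congˡ lw (upper y (+ k * + m) (+ j))))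
                    (qz-merge (+ k) (- (+ k * + suc j)) (- (+ k * + j)) (exponents (+ k) (+ j))) ⟩
        h j ∎)
        where
        P  = qbin (x - + 1 - + k * + m + + suc j - + 1) (+ k - + 1)
        P' = qbin (y + + 1 + + k * + m - + suc j) lw
        lower : ∀ x t j → x - + 1 - t + (+ 1 + j) - + 1 ≡ x - t + j - + 1
        lower = solve-∀
        upper : ∀ y t j → y + + 1 + t - (+ 1 + j) ≡ y + t - j
        upper = solve-∀
        exponents : ∀ k j → k + - (k * (+ 1 + j)) ≡ - (k * j)
        exponents = solve-∀

      corr-sum : sum1 m h ≈ cq ⊗ S' ⊕ (h m − h 0)
      corr-sum = trans (sum1-shift m h) (+-congʳ (trans (sum1-cong m corr-shifted) (sum1-* m cq _)))

      corr-first : h 0 ≈ a₀ ⊗ b₁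
      corr-first = trans (*-cong (*-cong (qbin-congˡ (+ k - + 1) (drop-zero X)) (qbin-congˡ lw (ℤP.+-identityʳ Y)))
                                 (qz-cong (exponent (+ k))))
                         (*-identityʳ _)
        where
        drop-zero : ∀ x → x + + 0 - + 1 ≡ x - + 1
        drop-zero = solve-∀
        exponent : ∀ k → - (k * + 0) ≡ + 0
        exponent = solve-∀

      edge-next : edge n x y (suc k) ≈ (qz E ⊗ cq) ⊗ w ⊗ a₁ ⊗ b₀
      edge-next = begin
        qz E₁ ⊗ ((P ⊗ P') ⊗ qz N)
          ≈⟨ *-congˡ (*-congʳ (*-cong (qbin-congˡ (+ k) (lower x (+ k) (+ m)))
                                      (qbin-cong (upper y (+ k) (+ m)) (index (+ n) (+ k))))) ⟩
        qz E₁ ⊗ ((a₁ ⊗ b₀) ⊗ qz N)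
          ≈⟨ solve 4 (λ e a b f → e :* ((a :* b) :* f) := (e :* f) :* a :* b) refl _ _ _ _ ⟩
        (qz E₁ ⊗ qz N) ⊗ a₁ ⊗ b₀
          ≈⟨ *-congʳ (*-congʳ (trans (qz-merge E₁ N (E + + k + (Y + + 1 - lw)) (exponents (+ k) (+ m) y (+ n)))
                                     (trans (qz-+ (E + + k) _) (*-congʳ (qz-+ E (+ k)))))) ⟩
        (qz E ⊗ cq) ⊗ w ⊗ a₁ ⊗ b₀ ∎
        where
        E₁ = expo n y (suc k)
        N  = - (+ suc k * + m)
        P  = qbin (x - + suc k * + m + + m - + 1) (+ k)
        P' = qbin (y + + suc k * + m - + m) (+ n - + suc k)
        lower : ∀ x k m → x - (+ 1 + k) * m + m - + 1 ≡ x - k * m - + 1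
        lower = solve-∀
        upper : ∀ y k m → y + (+ 1 + k) * m - m ≡ y + k * m
        upper = solve-∀
        index : ∀ n k → n - (+ 1 + k) ≡ n - k - + 1
        index = solve-∀
        exponents : ∀ k m y n → (+ 1 + k) * ((+ 1 + k) * m + (+ 1 + k) + y - n) + - ((+ 1 + k) * m)
                                ≡ k * (k * m + k + y - n) + k + (y + k * m + + 1 - (n - k))
        exponents = solve-∀

      expo-shifted : qz (expo n (y + + 1) k) ≈ qz E ⊗ cq
      expo-shifted = trans (qz-cong (exponents (+ k) (+ m) y (+ n))) (qz-+ E (+ k))
        where
        exponents : ∀ k m y n → k * (k * m + k + (y + + 1) - n) ≡ k * (k * m + k + y - n) + k
        exponents = solve-∀

    term-shift : term n x y k ≈ term n (x - + 1) (y + + 1) k ⊕ (edge n x y k − edge n x y (suc k))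
    term-shift = begin
      qz E ⊗ (lead n x y k ⊕ sum1 m h)
        ≈⟨ *-congˡ (+-cong lead-pascal (trans corr-sum (+-congˡ (+-congˡ (-‿cong corr-first))))) ⟩
      qz E ⊗ ((cq ⊗ a₁ ⊕ a₀) ⊗ b₁ ⊕ (cq ⊗ S' ⊕ (h m − (a₀ ⊗ b₁))))
        ≈⟨ solve 9 (λ e c a₁ a₀ b₁ b₀ w s hm →
              e :* ((c :* a₁ :+ a₀) :* b₁ :+ (c :* s :+ (hm :- a₀ :* b₁)))
              := (e :* c) :* (a₁ :* (b₁ :+ w :* b₀) :+ s) :+ (e :* hm :- (e :* c) :* w :* a₁ :* b₀))
            refl (qz E) cq a₁ a₀ b₁ b₀ w S' (h m) ⟩
      (qz E ⊗ cq) ⊗ (a₁ ⊗ (b₁ ⊕ w ⊗ b₀) ⊕ S') ⊕ ((qz E ⊗ h m) − ((qz E ⊗ cq) ⊗ w ⊗ a₁ ⊗ b₀))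
        ≈⟨ +-cong (*-cong expo-shifted (+-congʳ lead-shifted)) (+-congˡ (-‿cong edge-next)) ⟨
      term n (x - + 1) (y + + 1) k ⊕ (edge n x y k − edge n x y (suc k)) ∎

  -- Recurrence (X) summand by summand: Pascal's rule pascal₁ applied to
  -- the factor [x-km(+j-1), k(-1)] of every product.  The summand k = 0
  -- does not depend on x at all.
  term-x-step-zero : ∀ n x y → term (suc n) x y 0 ≡ term (suc n) (x - + 1) y 0
  term-x-step-zero n x y = ≡.refl

  module _ (n : ℕ) (x y : ℤ) (k : ℕ) where
    private
      X  = x - + suc k * + m
      Y  = y + + suc k * + m
      l  = + suc n - + suc k
      x' = x - + m - + 1
      y' = y + + m
      v  = qz (X - + suc k)

      index : + n - + k ≡ l
      index = shift (+ n) (+ k)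
        where
        shift : ∀ n k → n - k ≡ (+ 1 + n) - (+ 1 + k)
        shift = solve-∀

      lead-split : lead (suc n) x y (suc k) ≈ lead (suc n) (x - + 1) y (suc k) ⊕ v ⊗ lead n x' y' k
      lead-split = begin
        qbin X (+ suc k) ⊗ qbin Y l
          ≈⟨ *-congʳ (pascal₁ X (+ suc k)) ⟩
        (qbin (X - + 1) (+ suc k) ⊕ v ⊗ qbin (X - + 1) (+ k)) ⊗ qbin Y l
          ≈⟨ solve 4 (λ p v r b → (p :+ v :* r) :* b := p :* b :+ v :* (r :* b)) refl _ _ _ _ ⟩
        qbin (X - + 1) (+ suc k) ⊗ qbin Y l ⊕ v ⊗ (qbin (X - + 1) (+ k) ⊗ qbin Y l)
          ≈⟨ +-cong (*-congʳ (qbin-congˡ (+ suc k) (swap x (+ k) (+ m))))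
                    (*-congˡ (*-cong (qbin-congˡ (+ k) (split x (+ k) (+ m))) (qbin-cong (merge y (+ k) (+ m)) (≡.sym index)))) ⟩
        lead (suc n) (x - + 1) y (suc k) ⊕ v ⊗ lead n x' y' k ∎
        where
        swap : ∀ x k m → x - (+ 1 + k) * m - + 1 ≡ x - + 1 - (+ 1 + k) * m
        swap = solve-∀
        split : ∀ x k m → x - (+ 1 + k) * m - + 1 ≡ x - m - + 1 - k * m
        split = solve-∀
        merge : ∀ y k m → y + (+ 1 + k) * m ≡ y + m + k * m
        merge = solve-∀

      corr-split : ∀ j → corr (suc n) x y (suc k) j ≈ corr (suc n) (x - + 1) y (suc k) j ⊕ v ⊗ corr n x' y' k j
      corr-split j = begin
        (qbin Z (+ k) ⊗ b) ⊗ e₁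
          ≈⟨ *-congʳ (*-congʳ (pascal₁ Z (+ k))) ⟩
        ((P ⊕ u ⊗ P') ⊗ b) ⊗ e₁
          ≈⟨ solve 5 (λ p u r b e → ((p :+ u :* r) :* b) :* e := (p :* b) :* e :+ (u :* e) :* (r :* b)) refl P u P' b e₁ ⟩
        (P ⊗ b) ⊗ e₁ ⊕ (u ⊗ e₁) ⊗ (P' ⊗ b)
          ≈⟨ +-congˡ (*-congʳ (qz-regroup (Z - + k) (- (+ suc k * + j)) (X - + suc k) (- (+ k * + j)) (exponents x (+ k) (+ m) (+ j)))) ⟩
        (P ⊗ b) ⊗ e₁ ⊕ (v ⊗ e₀) ⊗ (P' ⊗ b)
          ≈⟨ +-congˡ (solve 4 (λ v e r b → (v :* e) :* (r :* b) := v :* ((r :* b) :* e)) refl _ _ _ _) ⟩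
        (P ⊗ b) ⊗ e₁ ⊕ v ⊗ ((P' ⊗ b) ⊗ e₀)
          ≈⟨ +-cong (*-congʳ (*-congʳ (qbin-congˡ (+ k) (swap x (+ k) (+ m) (+ j)))))
                    (*-congˡ (*-congʳ (*-cong (qbin-congˡ (+ k - + 1) (split x (+ k) (+ m) (+ j)))
                                              (qbin-cong (merge y (+ k) (+ m) (+ j)) (≡.sym index))))) ⟩
        corr (suc n) (x - + 1) y (suc k) j ⊕ v ⊗ corr n x' y' k j ∎
        where
        Z  = X + + j - + 1
        b  = qbin (Y - + j) l
        e₁ = qz (- (+ suc k * + j))
        e₀ = qz (- (+ k * + j))
        P  = qbin (Z - + 1) (+ k)
        u  = qz (Z - + k)
        P' = qbin (Z - + 1) (+ k - + 1)
        exponents : ∀ x k m j → (x - (+ 1 + k) * m + j - + 1 - k) + - ((+ 1 + k) * j)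
                                ≡ (x - (+ 1 + k) * m - (+ 1 + k)) + - (k * j)
        exponents = solve-∀
        swap : ∀ x k m j → x - (+ 1 + k) * m + j - + 1 - + 1 ≡ x - + 1 - (+ 1 + k) * m + j - + 1
        swap = solve-∀
        split : ∀ x k m j → x - (+ 1 + k) * m + j - + 1 - + 1 ≡ x - m - + 1 - k * m + j - + 1
        split = solve-∀
        merge : ∀ y k m j → y + (+ 1 + k) * m - j ≡ y + m + k * m - j
        merge = solve-∀

      expo-merge : qz (expo (suc n) y (suc k)) ⊗ v ≈ qz (x + y - + suc n) ⊗ qz (expo n y' k)
      expo-merge = qz-regroup (expo (suc n) y (suc k)) (X - + suc k) (x + y - + suc n) (expo n y' k)
                              (exponents (+ k) (+ m) x y (+ n))
        where
        exponents : ∀ k m x y n → (+ 1 + k) * ((+ 1 + k) * m + (+ 1 + k) + y - (+ 1 + n)) + (x - (+ 1 + k) * m - (+ 1 + k))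
                                  ≡ (x + y - (+ 1 + n)) + k * (k * m + k + (y + m) - n)
        exponents = solve-∀

    term-x-step : term (suc n) x y (suc k) ≈ term (suc n) (x - + 1) y (suc k) ⊕ qz (x + y - + suc n) ⊗ term n x' y' k
    term-x-step = begin
      e ⊗ (lead (suc n) x y (suc k) ⊕ sum1 m (corr (suc n) x y (suc k)))
        ≈⟨ *-congˡ (+-cong lead-split (trans (sum1-cong m (λ j → corr-split (suc j)))
                                         (trans (sum1-+ m _ _) (+-congˡ (sum1-* m v _))))) ⟩
      e ⊗ ((A₁ ⊕ v ⊗ A₀) ⊕ (S₁ ⊕ v ⊗ S₀))
        ≈⟨ solve 6 (λ e v a₁ a₀ s₁ s₀ → e :* ((a₁ :+ v :* a₀) :+ (s₁ :+ v :* s₀))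
                     := e :* (a₁ :+ s₁) :+ (e :* v) :* (a₀ :+ s₀)) refl _ _ _ _ _ _ ⟩
      e ⊗ (A₁ ⊕ S₁) ⊕ (e ⊗ v) ⊗ (A₀ ⊕ S₀)
        ≈⟨ +-congˡ (trans (*-congʳ expo-merge) (*-assoc _ _ _)) ⟩
      term (suc n) (x - + 1) y (suc k) ⊕ qz (x + y - + suc n) ⊗ term n x' y' k ∎
      where
      e  = qz (expo (suc n) y (suc k))
      A₁ = lead (suc n) (x - + 1) y (suc k)
      A₀ = lead n x' y' k
      S₁ = sum1 m (corr (suc n) (x - + 1) y (suc k))
      S₀ = sum1 m (corr n x' y' k)

  lhs-y-step : ∀ n x y → lhs (suc n) x y ≈ pow q (suc n) ⊗ lhs (suc n) x (y - + 1) ⊕ lhs n x (y - + 1)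
  lhs-y-step n x y = begin
    sum0 (suc n) (term (suc n) x y)
      ≈⟨ sum0-cong (suc n) (term-y-step n x y) ⟩
    sum0 (suc n) (λ k → pow q (suc n) ⊗ term (suc n) x y' k ⊕ term n x y' k)
      ≈⟨ sum0-+ (suc n) _ _ ⟩
    sum0 (suc n) (λ k → pow q (suc n) ⊗ term (suc n) x y' k) ⊕ (lhs n x y' ⊕ term n x y' (suc n))
      ≈⟨ +-cong (sum0-* (suc n) _ _) (trans (+-congˡ (term-beyond n x y')) (+-identityʳ _)) ⟩
    pow q (suc n) ⊗ lhs (suc n) x y' ⊕ lhs n x y' ∎
    where
    y' = y - + 1

  -- (S)  L_n(x,y) = L_n(x-1,y+1): the edge terms telescope to edge 0 - edge (n+1) = 0
  lhs-shift : ∀ n x y → lhs n x y ≈ lhs n (x - + 1) (y + + 1)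
  lhs-shift n x y = begin
    sum0 n (term n x y)
      ≈⟨ sum0-cong n (term-shift n x y) ⟩
    sum0 n (λ k → term n (x - + 1) (y + + 1) k ⊕ (edge n x y k − edge n x y (suc k)))
      ≈⟨ sum0-+ n _ _ ⟩
    lhs n (x - + 1) (y + + 1) ⊕ sum0 n (λ k → edge n x y k − edge n x y (suc k))
      ≈⟨ +-congˡ (sum0-telescope n (edge n x y)) ⟩
    lhs n (x - + 1) (y + + 1) ⊕ (edge n x y 0 − edge n x y (suc n))
      ≈⟨ +-congˡ (trans (+-cong edge-first (trans (-‿cong edge-beyond) -0#≈0#)) (+-identityʳ 0#)) ⟩
    lhs n (x - + 1) (y + + 1) ⊕ 0#
      ≈⟨ +-identityʳ _ ⟩
    lhs n (x - + 1) (y + + 1) ∎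
    where
    -- both edges contain a factor [·, -1]
    edge-first : edge n x y 0 ≈ 0#
    edge-first = trans (*-congˡ (trans (*-congʳ (zeroˡ _)) (zeroˡ _))) (zeroʳ _)
    edge-beyond : edge n x y (suc n) ≈ 0#
    edge-beyond = trans (*-congˡ (trans (*-congʳ (trans (*-congˡ (qbin-minus-one n _)) (zeroʳ _))) (zeroˡ _))) (zeroʳ _)

  lhs-x-step : ∀ n x y → lhs (suc n) x y ≈ lhs (suc n) (x - + 1) y ⊕ qz (x + y - + suc n) ⊗ lhs n (x - + m - + 1) (y + + m)
  lhs-x-step n x y = begin
    sum0 (suc n) (term (suc n) x y)
      ≈⟨ sum0-first n _ ⟩
    term (suc n) x y 0 ⊕ sum0 n (λ k → term (suc n) x y (suc k))
      ≈⟨ +-cong (reflexive (term-x-step-zero n x y))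
                (trans (sum0-cong n (term-x-step n x y)) (trans (sum0-+ n _ _) (+-congˡ (sum0-* n _ _)))) ⟩
    term (suc n) (x - + 1) y 0 ⊕ (sum0 n (λ k → term (suc n) (x - + 1) y (suc k)) ⊕ s ⊗ L')
      ≈⟨ +-assoc _ _ _ ⟨
    (term (suc n) (x - + 1) y 0 ⊕ sum0 n (λ k → term (suc n) (x - + 1) y (suc k))) ⊕ s ⊗ L'
      ≈⟨ +-congʳ (sum0-first n _) ⟨
    lhs (suc n) (x - + 1) y ⊕ s ⊗ L' ∎
    where
    s  = qz (x + y - + suc n)
    L' = lhs n (x - + m - + 1) (y + + m)

  eliminate : ∀ {A B C} p s → A ≈ B ⊕ s ⊗ C → A ≈ p ⊗ B ⊕ C → (1# − p) ⊗ A ≈ (1# − (s ⊗ p)) ⊗ C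
  eliminate {A} {B} {C} p s A≈B+sC A≈pB+C = begin
    (1# − p) ⊗ A               ≈⟨ solve 2 (λ p a → (con (+ 1) :- p) :* a := a :- p :* a) refl p A ⟩
    A − (p ⊗ A)                ≈⟨ +-cong A≈pB+C (-‿cong (*-congˡ A≈B+sC)) ⟩
    (p ⊗ B ⊕ C) − (p ⊗ (B ⊕ s ⊗ C))
      ≈⟨ solve 4 (λ p s b c → (p :* b :+ c) :- p :* (b :+ s :* c) := (con (+ 1) :- s :* p) :* c) refl p s B C ⟩
    (1# − (s ⊗ p)) ⊗ C          ∎

  lhs-closed : ∀ n x y → lhs n x y ≈ qbin (x + y) (+ n)
  lhs-closed zero x y = trans (*-identityˡ _)
    (trans (+-cong (*-identityˡ _) (sum1-zero m (λ j → trans (*-congʳ (zeroˡ _)) (zeroˡ _)))) (+-identityʳ _))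
  lhs-closed (suc n) x y = begin
    A                                     ≈⟨ trans (*-congˡ (ds n)) (*-identityʳ A) ⟨
    A ⊗ ((1# − pow q (suc n)) ⊗ den n)    ≈⟨ solve 3 (λ a u d → a :* (u :* d) := (u :* a) :* d) refl A _ _ ⟩
    ((1# − pow q (suc n)) ⊗ A) ⊗ den n    ≈⟨ *-congʳ (eliminate (pow q (suc n)) (qz (x + y - + suc n)) eqX eqY) ⟩
    (1# − (qz (x + y - + suc n) ⊗ pow q (suc n))) ⊗ C ⊗ den n
                                          ≈⟨ *-congʳ (*-congʳ (+-congˡ (-‿cong (exponents-add (x + y) n)))) ⟩
    (1# − qz (x + y)) ⊗ C ⊗ den n        ≈⟨ absorb (x + y) n ⟨
    qbin (x + y) (+ suc n)               ∎
    where
    A = lhs (suc n) x y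
    C = qbin (x + y - + 1) (+ n)
    eqX : A ≈ lhs (suc n) (x - + 1) y ⊕ qz (x + y - + suc n) ⊗ C
    eqX = trans (lhs-x-step n x y)
      (+-congˡ (*-congˡ (trans (lhs-closed n (x - + m - + 1) (y + + m)) (qbin-congˡ (+ n) (total x y (+ m))))))
      where
      total : ∀ x y m → x - m - + 1 + (y + m) ≡ x + y - + 1
      total = solve-∀
    eqY : A ≈ pow q (suc n) ⊗ lhs (suc n) (x - + 1) y ⊕ C
    eqY = trans (lhs-shift (suc n) x y) (trans (lhs-y-step n (x - + 1) (y + + 1))
      (+-cong (*-congˡ (reflexive (≡.cong (lhs (suc n) (x - + 1)) (cancel y))))
              (trans (reflexive (≡.cong (lhs n (x - + 1)) (cancel y)))
                     (trans (lhs-closed n (x - + 1) y) (qbin-congˡ (+ n) (total x y))))))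
      where
      cancel : ∀ y → y + + 1 - + 1 ≡ y
      cancel = solve-∀
      total : ∀ x y → x - + 1 + y ≡ x + y - + 1
      total = solve-∀

mainTheorem3 : {c ℓ : Level} (R : CommutativeRing c ℓ) (Q : QData R) → DenSpec R Q →
    (m n : ℕ) (x y : ℤ) → + (m Data.Nat.* n) ≤ x → + 1 ≤ y →
    let open QOps R Q in sum0 n (λ k →
         qz (+ k * (+ k * + m + + k + y - + n)) ⊗
           ((qbin (x - + k * + m) (+ k) ⊗ qbin (y + + k * + m) (+ n - + k))
            ⊕ sum1 m (λ j →
                (qbin (x - + k * + m + + j - + 1) (+ k - + 1)
                   ⊗ qbin (y + + k * + m - + j) (+ n - + k))
                ⊗ qz (- (+ k * + j)))))
       ≋ qbin (x + y) (+ n)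
mainTheorem3 R Q ds m n x y _ _ = LeftHandSide.lhs-closed R Q ds m n x y
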